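{- Let $f:\mathcal{S}_n\to\mathcal{P}(B)$ be the bucketing function produced by the construction described in the context (for any choice of the order $\sigma$ and of the processing order of sequences). Then (i) each bucket $m\in B$ contains exactly $|\Sigma|$ sequences, i.e. $|\{s\in\mathcal{S}_n: m\in f(s)\}|=|\Sigma|$; (ii) $|f(s)|=n$ for each $s\in\mathcal{S}_n$; and (iii) $|B|=n|\Sigma|^{n-1}$, where $B$ is the set of buckets used.
   Context: $\Sigma$ is a finite alphabet with $|\Sigma|>1$, $n\ge1$, $\mathcal{S}_n=\Sigma^n$. Fix a bijection $\sigma:\{1,\ldots,|\Sigma|\}\to\Sigma$. Construction: initialize $f(s)=\emptyset$ for all $s$ and a counter $m=1$. Process the sequences $s=s_1\cdots s_n\in\mathcal{S}_n$ one by one in an arbitrary order; for each $s$ and each $i=1,\ldots,n$ in increasing order, if $s_i=\sigma(1)$ then for every $j=1,\ldots,|\Sigma|$ add bucket $m$ to $f(t)$ where $t=s_1\cdots s_{i-1}\sigma(j)s_{i+1}\cdots s_n$, and afterwards increment $m$ by one. The bucket set $B$ is the set of integers $m$ used, i.e. $\{1,\ldots,M\}$ where $M$ is the number of increments. -}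

module Defs where

open import Data.Nat using (ℕ; suc)
open import Data.Fin using (Fin; zero)
open import Data.Fin.Properties using () renaming (_≟_ to _≟ᶠ_)
open import Data.Fin.Subset using (Subset; inside; outside)
open import Data.Bool using (Bool; true; false)
open import Data.List using (List; []; _∷_; concatMap; length; map; lookup)
open import Data.Bool.ListAction using (any)
open import Data.Vec using (Vec; _[_]≔_) renaming (lookup to vlookup)
open import Data.Vec.Properties using (≡-dec)
open import Data.List using () renaming (allFin to allFinL)
open import Function.Bundles using (_↔_; Inverse)
open import Relation.Binary.PropositionalEquality using (_≡_; refl; cong)
open import Relation.Binary.Definitions using (DecidableEquality)
open import Relation.Nullary using (does; yes; no)
open import Relation.Nullary.Decidable using (map′)

-- The alphabet is an arbitrary type Σ together with the fixed bijection
-- σ : Fin k ↔ Σ, k = suc k₀ = |Σ| (Fin k = {1,…,k} shifted to {0,…,k-1}, so σ(1) is σ 0).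
module _ {Σ : Set} {k₀ : ℕ} (σ : Fin (suc k₀) ↔ Σ) where
  open Inverse σ renaming (to to σ→; from to σ←)

  decΣ : DecidableEquality Σ
  decΣ x y = map′ (λ e → trans' (sym' (strictlyInverseˡ x)) (trans' (cong σ→ e) (strictlyInverseˡ y)))
                  (cong σ←) (σ← x ≟ᶠ σ← y)
    where
    open import Relation.Binary.PropositionalEquality using () renaming (trans to trans'; sym to sym')

  bucketsOf : {n : ℕ} → Vec Σ n → List (List (Vec Σ n))
  bucketsOf {n} s = concatMap step (allFinL n)
    where
    step : Fin n → List (List (Vec Σ n))
    step i with decΣ (vlookup s i) (σ→ zero)
    ... | yes _ = map (λ j → s [ i ]≔ σ→ j) (allFinL (suc k₀)) ∷ []
    ... | no  _ = []

  -- All buckets, in creation order; bucket number m (1-based in the paper)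
  -- is index m-1 : Fin M of this list.  `order` is the processing order.
  buckets : {n : ℕ} → List (Vec Σ n) → List (List (Vec Σ n))
  buckets order = concatMap bucketsOf order

  numBuckets : {n : ℕ} → List (Vec Σ n) → ℕ
  numBuckets order = length (buckets order)

  bucketing : {n : ℕ} (order : List (Vec Σ n)) → Vec Σ n → Subset (numBuckets order)
  bucketing {n} order s = Data.Vec.tabulate (λ m → toBit (any (λ t → does (≡-dec decΣ s t)) (lookup (buckets order) m)))
    where
    import Data.Vec
    toBit : Bool → Data.Fin.Subset.Side
    toBit true = inside
    toBit false = outside

-- The bucket created for a sequence t at a position i with tᵢ = σ(1) is the line
-- {t[i := a] | a ∈ Σ} through t, so it has |Σ| elements. A sequence s lies in that bucket
-- exactly when t = s[i := σ(1)]; as every sequence is processed exactly once, s lies in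
-- exactly one bucket per position, i.e. in n buckets. Counting the incidences between
-- buckets and sequences in two ways then gives |B| · |Σ| = n · |Σ|ⁿ.

module Submission where

open import Defs
open import Data.Nat using (ℕ; suc; _*_; _^_)
open import Data.Fin using (Fin)
open import Data.Fin.Subset using (_∈_; ∣_∣)
open import Data.Vec using (Vec)
open import Data.List using (List)
open import Data.List.Membership.Propositional using () renaming (_∈_ to _∈ₗ_)
open import Data.List.Relation.Unary.Unique.Propositional using (Unique)
open import Data.Product using (_×_; Σ-syntax)
open import Function.Bundles using (_↔_)
open import Relation.Binary.PropositionalEquality using (_≡_)

open import Data.Bool using (true; false; _∨_; if_then_else_)
open import Data.Bool.ListAction using (any)
open import Data.Fin using (zero)
open import Data.List as List using ([]; _∷_; _++_; map; concatMap; length; allFin; cartesianProductWith)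
open import Data.List.Membership.Propositional.Properties
  using (∈-map⁺; ∈-map⁻; ∈-allFin; ∈-lookup; ∈-concatMap⁻; ∈-cartesianProductWith⁺)
open import Data.List.Properties
  using (map-++; map-cong; map-cong-local; length-++; length-map; length-tabulate; concatMap-cong)
open import Data.List.Relation.Unary.All as All using (All; []; _∷_)
open import Data.List.Relation.Unary.AllPairs using ([]; _∷_)
open import Data.List.Relation.Unary.Any using (here; satisfied)
open import Data.List.Relation.Unary.Unique.Propositional.Properties using (map⁺; allFin⁺; cartesianProductWith⁺)
open import Data.Nat using (zero; _+_; _∸_)
open import Data.Nat.ListAction using (sum)
open import Data.Nat.ListAction.Properties using (sum-++)
open import Data.Nat.Properties using (+-identityʳ; *-identityʳ; *-zeroʳ; *-cancelʳ-≡; +-commutativeSemigroup)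
open import Algebra.Properties.CommutativeSemigroup +-commutativeSemigroup using (interchange)
open import Data.Nat.Tactic.RingSolver using (solve-∀)
open import Data.Product using (∃₂; _,_)
open import Data.Product.Properties using (Σ-≡,≡→≡)
open import Data.Vec as Vec using ([]; _∷_; _[_]≔_; lookup)
open import Data.Vec.Properties
  using ( ≡-dec; ∷-injective; tabulate-cong; lookup∘tabulate; []=⇒lookup; lookup⇒[]=
        ; []≔-idempotent; []≔-lookup; lookup∘update)
open import Data.Vec.Properties.WithK using ([]=-irrelevant)
open import Function using (id; _⇔_; mk⇔; Inverse; mk↔ₛ′; Equivalence)
import Function.Properties.Equivalence as ⇔
open import Relation.Binary.Definitions using (DecidableEquality)
open import Relation.Binary.PropositionalEquality
  using (_≢_; _≗_; refl; sym; trans; cong; cong₂; subst; module ≡-Reasoning)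
open import Relation.Nullary using (Dec; does; yes; no; ¬_; Irrelevant)
open import Relation.Unary using (Decidable)
open import Relation.Nullary.Decidable using (does-⇔; dec-true; dec-false)

private
  variable
    A B C : Set

∑ : List A → (A → ℕ) → ℕ
∑ xs f = sum (map f xs)

syntax ∑ xs (λ x → e) = ∑[ x ∈ xs ] e

∑-cong : {f g : A → ℕ} → f ≗ g → ∀ xs → ∑ xs f ≡ ∑ xs g
∑-cong f≗g xs = cong sum (map-cong f≗g xs)

∑-cong-∈ : {f g : A → ℕ} (xs : List A) → (∀ {x} → x ∈ₗ xs → f x ≡ g x) → ∑ xs f ≡ ∑ xs g
∑-cong-∈ xs eq = cong sum (map-cong-local (All.tabulate eq))

∑-const : ∀ c (xs : List A) → ∑[ x ∈ xs ] c ≡ length xs * c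
∑-const c []       = refl
∑-const c (x ∷ xs) = cong (c +_) (∑-const c xs)

∑-one : ∀ (xs : List A) → ∑[ x ∈ xs ] 1 ≡ length xs
∑-one xs = trans (∑-const 1 xs) (*-identityʳ (length xs))

∑-+ : ∀ (f g : A → ℕ) xs → ∑[ x ∈ xs ] (f x + g x) ≡ ∑ xs f + ∑ xs g
∑-+ f g []       = refl
∑-+ f g (x ∷ xs) = trans (cong (f x + g x +_) (∑-+ f g xs)) (interchange (f x) (g x) _ _)

∑-++ : ∀ (f : A → ℕ) xs ys → ∑ (xs ++ ys) f ≡ ∑ xs f + ∑ ys f
∑-++ f xs ys = trans (cong sum (map-++ f xs ys)) (sum-++ (map f xs) (map f ys))

∑-concatMap : ∀ (f : B → ℕ) (g : A → List B) xs → ∑ (concatMap g xs) f ≡ ∑[ x ∈ xs ] ∑ (g x) f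
∑-concatMap f g []       = refl
∑-concatMap f g (x ∷ xs) = trans (∑-++ f (g x) (concatMap g xs)) (cong (∑ (g x) f +_) (∑-concatMap f g xs))

∑-comm : ∀ (f : A → B → ℕ) xs ys →
         ∑[ x ∈ xs ] ∑[ y ∈ ys ] f x y ≡ ∑[ y ∈ ys ] ∑[ x ∈ xs ] f x y
∑-comm f []       ys = sym (trans (∑-const 0 ys) (*-zeroʳ (length ys)))
∑-comm f (x ∷ xs) ys = trans (cong (∑ ys (f x) +_) (∑-comm f xs ys)) (sym (∑-+ (f x) _ ys))

𝟙 : {P : Set} → Dec P → ℕ
𝟙 p? = if does p? then 1 else 0

module _ {P : Set} where

  𝟙-yes : (p? : Dec P) → P → 𝟙 p? ≡ 1
  𝟙-yes p? p = cong (λ b → if b then 1 else 0) (dec-true p? p)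

  𝟙-no : (p? : Dec P) → ¬ P → 𝟙 p? ≡ 0
  𝟙-no p? ¬p = cong (λ b → if b then 1 else 0) (dec-false p? ¬p)

  does≡true⇒ : (p? : Dec P) → does p? ≡ true → P
  does≡true⇒ (yes p) _ = p

  𝟙-⇔ : {Q : Set} → P ⇔ Q → (p? : Dec P) (q? : Dec Q) → 𝟙 p? ≡ 𝟙 q?
  𝟙-⇔ P⇔Q p? q? = cong (λ b → if b then 1 else 0) (does-⇔ P⇔Q p? q?)

∣tabulate∘lookup∣ : ∀ {P : A → Set} (P? : Decidable P) xs →
                    ∣ Vec.tabulate (λ m → does (P? (List.lookup xs m))) ∣ ≡ ∑[ x ∈ xs ] 𝟙 (P? x)
∣tabulate∘lookup∣ P? []       = refl
∣tabulate∘lookup∣ P? (x ∷ xs) with does (P? x)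
... | true  = cong suc (∣tabulate∘lookup∣ P? xs)
... | false = ∣tabulate∘lookup∣ P? xs

Enumerates : List A → Set
Enumerates xs = Unique xs × (∀ x → x ∈ₗ xs)

module Multiplicity {A : Set} (_≟_ : DecidableEquality A) where
  open import Data.List.Membership.DecPropositional _≟_ public using (_∈?_)

  δ : A → A → ℕ
  δ x y = 𝟙 (x ≟ y)

  δ-sym : ∀ x y → δ x y ≡ δ y x
  δ-sym x y = 𝟙-⇔ (mk⇔ sym sym) (x ≟ y) (y ≟ x)

  any-≟ : ∀ x ys → any (λ y → does (x ≟ y)) ys ≡ does (x ∈? ys)
  any-≟ x []       = refl
  any-≟ x (y ∷ ys) = cong (does (x ≟ y) ∨_) (any-≟ x ys)

  ∑δ-∉ : ∀ {x} ys → All (x ≢_) ys → ∑[ y ∈ ys ] δ x y ≡ 0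
  ∑δ-∉ []       []             = refl
  ∑δ-∉ {x} (y ∷ ys) (x≢y ∷ x∉ys) = cong₂ _+_ (𝟙-no (x ≟ y) x≢y) (∑δ-∉ ys x∉ys)

  ∑δ-unique : ∀ {x ys} → Unique ys → ∑[ y ∈ ys ] δ x y ≡ 𝟙 (x ∈? ys)
  ∑δ-unique {ys = []}             []          = refl
  ∑δ-unique {x} {y ∷ ys} (y∉ys ∷ u) with x ≟ y
  ... | yes refl = cong suc (∑δ-∉ ys y∉ys)
  ... | no _     = ∑δ-unique u

  ∑δ-enumerates : ∀ {ys} → Enumerates ys → ∀ x → ∑[ y ∈ ys ] δ x y ≡ 1
  ∑δ-enumerates {ys} (u , complete) x = trans (∑δ-unique u) (𝟙-yes (x ∈? ys) (complete x))

  ∑∈?-length : ∀ {xs ys} → Unique xs → Enumerates ys → ∑[ y ∈ ys ] 𝟙 (y ∈? xs) ≡ length xs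
  ∑∈?-length {xs} {ys} u e = begin
    ∑[ y ∈ ys ] 𝟙 (y ∈? xs)        ≡⟨ ∑-cong (λ y → ∑δ-unique u) ys ⟨
    ∑[ y ∈ ys ] ∑[ x ∈ xs ] δ y x  ≡⟨ ∑-comm δ ys xs ⟩
    ∑[ x ∈ xs ] ∑[ y ∈ ys ] δ y x  ≡⟨ ∑-cong occurs-once xs ⟩
    ∑[ x ∈ xs ] 1                  ≡⟨ ∑-one xs ⟩
    length xs                      ∎
    where
    open ≡-Reasoning
    occurs-once : ∀ x → ∑[ y ∈ ys ] δ y x ≡ 1
    occurs-once x = trans (∑-cong (λ y → δ-sym y x) ys) (∑δ-enumerates e x)

  enumerates-length-≡ : ∀ {xs ys} → Enumerates xs → Enumerates ys → length ys ≡ length xs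
  enumerates-length-≡ {xs} {ys} (u , complete) e =
    trans (sym (trans (∑-cong (λ y → 𝟙-yes (y ∈? xs) (complete y)) ys) (∑-one ys))) (∑∈?-length u e)

length-cartesianProductWith : ∀ (f : A → B → C) xs ys →
                              length (cartesianProductWith f xs ys) ≡ length xs * length ys
length-cartesianProductWith f []       ys = refl
length-cartesianProductWith f (x ∷ xs) ys =
  trans (length-++ (map (f x) ys)) (cong₂ _+_ (length-map (f x) ys) (length-cartesianProductWith f xs ys))

vectors : List A → ∀ n → List (Vec A n)
vectors xs zero    = [] ∷ []
vectors xs (suc n) = cartesianProductWith _∷_ xs (vectors xs n)

vectors-enumerates : ∀ {xs : List A} → Enumerates xs → ∀ n → Enumerates (vectors xs n)
vectors-enumerates e       zero    = ([] ∷ []) , λ { [] → here refl }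
vectors-enumerates (u , c) (suc n) =
  let uₙ , cₙ = vectors-enumerates (u , c) n in
  cartesianProductWith⁺ _∷_ ∷-injective u uₙ ,
  λ { (x ∷ v) → ∈-cartesianProductWith⁺ _∷_ (c x) (cₙ v) }

length-vectors : ∀ (xs : List A) n → length (vectors xs n) ≡ length xs ^ n
length-vectors xs zero    = refl
length-vectors xs (suc n) =
  trans (length-cartesianProductWith _∷_ xs (vectors xs n)) (cong (length xs *_) (length-vectors xs n))

[]≔-lookup-swap : ∀ {n} (s t : Vec A n) i → s [ i ]≔ lookup t i ≡ t → t [ i ]≔ lookup s i ≡ s
[]≔-lookup-swap s t i e = begin
  t [ i ]≔ lookup s i                     ≡⟨ cong (_[ i ]≔ lookup s i) (sym e) ⟩
  (s [ i ]≔ lookup t i) [ i ]≔ lookup s i ≡⟨ []≔-idempotent s i ⟩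
  s [ i ]≔ lookup s i                     ≡⟨ []≔-lookup s i ⟩
  s                                       ∎
  where open ≡-Reasoning

k^n*n≡n*k^[n∸1]*k : ∀ k n → k ^ n * n ≡ n * k ^ (n ∸ 1) * k
k^n*n≡n*k^[n∸1]*k k zero    = refl
k^n*n≡n*k^[n∸1]*k k (suc n) = reorder k (k ^ n) n
  where
  reorder : ∀ k p n → k * p * suc n ≡ suc n * p * k
  reorder = solve-∀

module Buckets {A : Set} {k₀ : ℕ} (σ : Fin (suc k₀) ↔ A) where
  open Inverse σ renaming (to to σ→; from to σ←)

  k : ℕ
  k = suc k₀

  σ₁ : A
  σ₁ = σ→ zero

  open module Mult {n} = Multiplicity (≡-dec {n = n} (decΣ σ))

  σ→-injective : ∀ {i j} → σ→ i ≡ σ→ j → i ≡ j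
  σ→-injective {i} {j} e = trans (sym (strictlyInverseʳ i)) (trans (cong σ← e) (strictlyInverseʳ j))

  letters : List A
  letters = map σ→ (allFin k)

  letters-enumerates : Enumerates letters
  letters-enumerates =
    map⁺ σ→-injective (allFin⁺ k) ,
    λ a → subst (_∈ₗ letters) (strictlyInverseˡ a) (∈-map⁺ σ→ (∈-allFin (σ← a)))

  length-letters : length letters ≡ k
  length-letters = trans (length-map σ→ (allFin k)) (length-tabulate id)

  line : ∀ {n} → Vec A n → Fin n → List (Vec A n)
  line t i = map (λ j → t [ i ]≔ σ→ j) (allFin k)

  ∈-line⇔ : ∀ {n} {s t : Vec A n} {i} → s ∈ₗ line t i ⇔ t [ i ]≔ lookup s i ≡ s
  ∈-line⇔ {s = s} {t} {i} = mk⇔ to from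
    where
    to : s ∈ₗ line t i → t [ i ]≔ lookup s i ≡ s
    to s∈ with ∈-map⁻ (λ j → t [ i ]≔ σ→ j) s∈
    ... | j , _ , refl = cong (t [ i ]≔_) (lookup∘update i t (σ→ j))
    from : t [ i ]≔ lookup s i ≡ s → s ∈ₗ line t i
    from e = subst (_∈ₗ line t i) (trans (cong (t [ i ]≔_) (strictlyInverseˡ (lookup s i))) e)
                   (∈-map⁺ (λ j → t [ i ]≔ σ→ j) (∈-allFin (σ← (lookup s i))))

  line-unique : ∀ {n} (t : Vec A n) i → Unique (line t i)
  line-unique t i = map⁺ injective (allFin⁺ k)
    where
    injective : ∀ {j j′} → t [ i ]≔ σ→ j ≡ t [ i ]≔ σ→ j′ → j ≡ j′
    injective {j} {j′} e =
      σ→-injective (trans (sym (lookup∘update i t (σ→ j)))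
                          (trans (cong (λ v → lookup v i) e) (lookup∘update i t (σ→ j′))))

  length-line : ∀ {n} (t : Vec A n) i → length (line t i) ≡ k
  length-line t i = trans (length-map _ (allFin k)) (length-tabulate id)

  line-↔ : ∀ {n} (P : Vec A n → Set) {t i} →
           (∀ s → P s ⇔ s ∈ₗ line t i) → (∀ {s} → Irrelevant (P s)) → Fin k ↔ (Σ[ s ∈ Vec A n ] P s)
  line-↔ {n} P {t} {i} P⇔ irrelevant = mk↔ₛ′ to from to∘from from∘to
    where
    to : Fin k → Σ[ s ∈ Vec A n ] P s
    to j = t [ i ]≔ σ→ j , Equivalence.from (P⇔ _) (∈-map⁺ (λ j → t [ i ]≔ σ→ j) (∈-allFin j))
    from : Σ[ s ∈ Vec A n ] P s → Fin k
    from (s , _) = σ← (lookup s i)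
    to∘from : ∀ y → to (from y) ≡ y
    to∘from (s , p) = Σ-≡,≡→≡ (trans (cong (t [ i ]≔_) (strictlyInverseˡ _)) s-on-line , irrelevant _ _)
      where
      s-on-line : t [ i ]≔ lookup s i ≡ s
      s-on-line = Equivalence.to ∈-line⇔ (Equivalence.to (P⇔ s) p)
    from∘to : ∀ j → from (to j) ≡ j
    from∘to j = trans (cong σ← (lookup∘update i t (σ→ j))) (strictlyInverseʳ j)

  bucketAt : ∀ {n} → Vec A n → Fin n → List (List (Vec A n))
  bucketAt t i with decΣ σ (lookup t i) σ₁
  ... | yes _ = line t i ∷ []
  ... | no  _ = []

  -- The step function of bucketsOf is local to Defs; the left-hand side of step≗bucketAt is
  -- inferred from its use in bucketsOf-≡.
  mutual
    bucketsOf-≡ : ∀ {n} (t : Vec A n) → bucketsOf σ t ≡ concatMap (bucketAt t) (allFin n)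
    bucketsOf-≡ t = concatMap-cong (step≗bucketAt t) (allFin _)

    step≗bucketAt : ∀ {n} (t : Vec A n) (i : Fin n) → _ ≡ bucketAt t i
    step≗bucketAt t i with decΣ σ (lookup t i) σ₁
    ... | yes _ = refl
    ... | no  _ = refl

  ∈-bucketAt : ∀ {n b} (t : Vec A n) i → b ∈ₗ bucketAt t i → b ≡ line t i
  ∈-bucketAt t i b∈ with decΣ σ (lookup t i) σ₁ | b∈
  ... | yes _ | here b≡line = b≡line

  ∈-buckets : ∀ {n b} (order : List (Vec A n)) → b ∈ₗ buckets σ order → ∃₂ λ t i → b ≡ line t i
  ∈-buckets order b∈ with satisfied (∈-concatMap⁻ (bucketsOf σ) {xs = order} b∈)
  ... | t , b∈bucketsOf
    with satisfied (∈-concatMap⁻ (bucketAt t) {xs = allFin _} (subst (_ ∈ₗ_) (bucketsOf-≡ t) b∈bucketsOf))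
  ... | i , b∈bucketAt = t , i , ∈-bucketAt t i b∈bucketAt

  -- Likewise the left-hand side of side≡any is the local Bool → Side conversion of bucketing.
  mutual
    bucketing-≡ : ∀ {n} (order : List (Vec A n)) s →
                  bucketing σ order s ≡ Vec.tabulate (λ m → does (s ∈? List.lookup (buckets σ order) m))
    bucketing-≡ order s =
      tabulate-cong (λ m → trans (side≡any order s m) (any-≟ s (List.lookup (buckets σ order) m)))

    side≡any : ∀ {n} (order : List (Vec A n)) s m →
               _ ≡ any (λ t → does (≡-dec (decΣ σ) s t)) (List.lookup (buckets σ order) m)
    side≡any order s m with any (λ t → does (≡-dec (decΣ σ) s t)) (List.lookup (buckets σ order) m)
    ... | true  = refl
    ... | false = refl

  lookup-bucketing : ∀ {n} (order : List (Vec A n)) s m →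
                     lookup (bucketing σ order s) m ≡ does (s ∈? List.lookup (buckets σ order) m)
  lookup-bucketing order s m = trans (cong (λ v → lookup v m) (bucketing-≡ order s)) (lookup∘tabulate _ m)

  ∈-bucketing⇔ : ∀ {n} (order : List (Vec A n)) {s m} →
                 m ∈ bucketing σ order s ⇔ s ∈ₗ List.lookup (buckets σ order) m
  ∈-bucketing⇔ order {s} {m} = mk⇔
    (λ m∈ → does≡true⇒ (s ∈? _) (trans (sym (lookup-bucketing order s m)) ([]=⇒lookup m∈)))
    (λ s∈ → lookup⇒[]= m _ (trans (lookup-bucketing order s m) (dec-true (s ∈? _) s∈)))

  ∣bucketing∣ : ∀ {n} (order : List (Vec A n)) s →
                ∣ bucketing σ order s ∣ ≡ ∑[ b ∈ buckets σ order ] 𝟙 (s ∈? b)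
  ∣bucketing∣ order s =
    trans (cong ∣_∣ (bucketing-≡ order s)) (∣tabulate∘lookup∣ (s ∈?_) (buckets σ order))

  incidences-bucketAt : ∀ {n} (s t : Vec A n) i → ∑[ b ∈ bucketAt t i ] 𝟙 (s ∈? b) ≡ δ (s [ i ]≔ σ₁) t
  incidences-bucketAt s t i with decΣ σ (lookup t i) σ₁
  ... | yes tᵢ≡σ₁ = trans (+-identityʳ _)
    (𝟙-⇔ (⇔.trans ∈-line⇔ (mk⇔ to from)) (s ∈? line t i) (≡-dec (decΣ σ) (s [ i ]≔ σ₁) t))
    where
    to : t [ i ]≔ lookup s i ≡ s → s [ i ]≔ σ₁ ≡ t
    to e = subst (λ a → s [ i ]≔ a ≡ t) tᵢ≡σ₁ ([]≔-lookup-swap t s i e)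
    from : s [ i ]≔ σ₁ ≡ t → t [ i ]≔ lookup s i ≡ s
    from e = []≔-lookup-swap s t i (subst (λ a → s [ i ]≔ a ≡ t) (sym tᵢ≡σ₁) e)
  ... | no tᵢ≢σ₁ = sym (𝟙-no (≡-dec (decΣ σ) (s [ i ]≔ σ₁) t) λ e →
    tᵢ≢σ₁ (trans (cong (λ v → lookup v i) (sym e)) (lookup∘update i s σ₁)))

  incidences-bucketsOf : ∀ {n} (s t : Vec A n) →
                         ∑[ b ∈ bucketsOf σ t ] 𝟙 (s ∈? b) ≡ ∑[ i ∈ allFin n ] δ (s [ i ]≔ σ₁) t
  incidences-bucketsOf {n} s t = begin
    ∑[ b ∈ bucketsOf σ t ] 𝟙 (s ∈? b)
      ≡⟨ cong (λ bs → ∑[ b ∈ bs ] 𝟙 (s ∈? b)) (bucketsOf-≡ t) ⟩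
    ∑[ b ∈ concatMap (bucketAt t) (allFin n) ] 𝟙 (s ∈? b)
      ≡⟨ ∑-concatMap _ (bucketAt t) (allFin n) ⟩
    ∑[ i ∈ allFin n ] ∑[ b ∈ bucketAt t i ] 𝟙 (s ∈? b)
      ≡⟨ ∑-cong (incidences-bucketAt s t) (allFin n) ⟩
    ∑[ i ∈ allFin n ] δ (s [ i ]≔ σ₁) t
      ∎
    where open ≡-Reasoning

  ∣bucketing∣≡n : ∀ {n} {order : List (Vec A n)} → Enumerates order →
                  ∀ s → ∣ bucketing σ order s ∣ ≡ n
  ∣bucketing∣≡n {n} {order} e s = begin
    ∣ bucketing σ order s ∣                              ≡⟨ ∣bucketing∣ order s ⟩
    ∑[ b ∈ buckets σ order ] 𝟙 (s ∈? b)                  ≡⟨ ∑-concatMap _ (bucketsOf σ) order ⟩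
    ∑[ t ∈ order ] ∑[ b ∈ bucketsOf σ t ] 𝟙 (s ∈? b)     ≡⟨ ∑-cong (incidences-bucketsOf s) order ⟩
    ∑[ t ∈ order ] ∑[ i ∈ allFin n ] δ (s [ i ]≔ σ₁) t   ≡⟨ ∑-comm _ order (allFin n) ⟩
    ∑[ i ∈ allFin n ] ∑[ t ∈ order ] δ (s [ i ]≔ σ₁) t   ≡⟨ ∑-cong one-bucket-per-position (allFin n) ⟩
    ∑[ i ∈ allFin n ] 1                                  ≡⟨ ∑-one (allFin n) ⟩
    length (allFin n)                                    ≡⟨ length-tabulate id ⟩
    n                                                    ∎
    where
    open ≡-Reasoning
    one-bucket-per-position : ∀ i → ∑[ t ∈ order ] δ (s [ i ]≔ σ₁) t ≡ 1
    one-bucket-per-position i = ∑δ-enumerates e (s [ i ]≔ σ₁)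

  bucket-↔ : ∀ {n} (order : List (Vec A n)) (m : Fin (numBuckets σ order)) →
             Fin k ↔ (Σ[ s ∈ Vec A n ] m ∈ bucketing σ order s)
  bucket-↔ order m with ∈-buckets order (∈-lookup m)
  ... | t , i , b≡line = line-↔ (λ s → m ∈ bucketing σ order s)
    (λ s → ⇔.trans (∈-bucketing⇔ order) (mk⇔ (subst (s ∈ₗ_) b≡line) (subst (s ∈ₗ_) (sym b≡line))))
    []=-irrelevant

  length-enumeration≡k^n : ∀ {n} {order : List (Vec A n)} → Enumerates order → length order ≡ k ^ n
  length-enumeration≡k^n {n} {order} e = begin
    length order                ≡⟨ enumerates-length-≡ (vectors-enumerates letters-enumerates n) e ⟩
    length (vectors letters n)  ≡⟨ length-vectors letters n ⟩
    length letters ^ n          ≡⟨ cong (_^ n) length-letters ⟩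
    k ^ n                       ∎
    where open ≡-Reasoning

  numBuckets*k : ∀ {n} {order : List (Vec A n)} → Enumerates order → numBuckets σ order * k ≡ k ^ n * n
  numBuckets*k {n} {order} e = begin
    numBuckets σ order * k                                 ≡⟨ ∑-const k (buckets σ order) ⟨
    ∑[ b ∈ buckets σ order ] k                             ≡⟨ ∑-cong-∈ (buckets σ order) bucket-size ⟨
    ∑[ b ∈ buckets σ order ] ∑[ s ∈ order ] 𝟙 (s ∈? b)     ≡⟨ ∑-comm _ (buckets σ order) order ⟩
    ∑[ s ∈ order ] ∑[ b ∈ buckets σ order ] 𝟙 (s ∈? b)     ≡⟨ ∑-cong sequence-incidences order ⟩
    ∑[ s ∈ order ] n                                       ≡⟨ ∑-const n order ⟩
    length order * n                                       ≡⟨ cong (_* n) (length-enumeration≡k^n e) ⟩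
    k ^ n * n                                              ∎
    where
    open ≡-Reasoning
    sequence-incidences : ∀ s → ∑[ b ∈ buckets σ order ] 𝟙 (s ∈? b) ≡ n
    sequence-incidences s = trans (sym (∣bucketing∣ order s)) (∣bucketing∣≡n e s)
    bucket-size : ∀ {b} → b ∈ₗ buckets σ order → ∑[ s ∈ order ] 𝟙 (s ∈? b) ≡ k
    bucket-size b∈ with ∈-buckets order b∈
    ... | t , i , refl = trans (∑∈?-length (line-unique t i) e) (length-line t i)

lemma4 : {Σ : Set} {k₀ : ℕ} → 1 Data.Nat.≤ k₀ → (σ : Fin (suc k₀) ↔ Σ) → (n : ℕ) → 1 Data.Nat.≤ n →
         (order : List (Vec Σ n)) → Unique order → (∀ s → s ∈ₗ order) →
         ((m : Fin (numBuckets σ order)) → (Fin (suc k₀) ↔ (Σ[ s ∈ Vec Σ n ] (m ∈ bucketing σ order s))))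
         × ((s : Vec Σ n) → ∣ bucketing σ order s ∣ ≡ n)
         × (numBuckets σ order ≡ n * suc k₀ ^ (n Data.Nat.∸ 1))
lemma4 {k₀ = k₀} _ σ n _ order unique complete =
  bucket-↔ order ,
  ∣bucketing∣≡n e ,
  *-cancelʳ-≡ _ _ (suc k₀) (trans (numBuckets*k e) (k^n*n≡n*k^[n∸1]*k (suc k₀) n))
  where
  open Buckets σ
  e : Enumerates order
  e = unique , complete
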